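{- Let $X$ be a simplicial complex. Then $\theta(X)=1$ if and only if $X=\mathrm{Ind}(G)$ for some co-chordal graph $G$ with at least one edge.
   Context: A simplicial complex $X$ on a finite set $V$ is a family of subsets of $V$ closed under taking subsets. For a vertex $v$ (i.e. $\{v\}\in X$), $\mathrm{del}(X;v)=\{S\in X:v\notin S\}$, $\mathrm{lk}(X;v)=\{T\in X:v\notin T,\ T\cup\{v\}\in X\}$; $v$ is a cone vertex if $\mathrm{lk}(X;v)=\mathrm{del}(X;v)$, and $V(X)^\circ$ is the set of non-cone vertices. Theta-number: $\theta(X)=0$ if $V(X)^\circ=\emptyset$, otherwise $\theta(X)=\min_{v\in V(X)^\circ}\max\{\theta(\mathrm{del}(X;v)),\theta(\mathrm{lk}(X;v))+1\}$. For a finite simple graph $G$, $\mathrm{Ind}(G)$ is the complex of independent sets of $G$. A graph is chordal if it has no induced cycle of length greater than $3$, and co-chordal if its complement is chordal. -}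

module Defs where

open import Data.Nat using (ℕ; zero; suc; _⊔_; _⊓_; _≥_; _∸_)
open import Data.Fin using (Fin; toℕ)
open import Data.Fin.Subset using (Subset; _∈_; _⊆_; ⁅_⁆; inside; outside)
open import Data.Bool using (Bool; true; false; _∧_; not; if_then_else_)
open import Data.Bool.Properties using () renaming (_≟_ to _≟ᵇ_)
open import Data.Vec using (Vec; []; _∷_; lookup; _[_]≔_)
open import Data.List using (List; []; _∷_; _++_; map; foldr)
open import Data.List using () renaming (allFin to allFinL)
open import Data.Product using (Σ; ∃; _×_; _,_)
open import Data.Sum using (_⊎_)
open import Data.Empty using (⊥)
open import Relation.Nullary using (¬_; does)
open import Relation.Binary.PropositionalEquality using (_≡_; _≢_)
open import Function.Definitions using (Injective)
open import Function.Bundles using (_⇔_)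

Family : ℕ → Set
Family n = Subset n → Bool

IsSimplicialComplex : ∀ {n} → Family n → Set
IsSimplicialComplex {n} X = ∀ (S T : Subset n) → T ⊆ S → X S ≡ true → X T ≡ true

allSubsets : (n : ℕ) → List (Subset n)
allSubsets zero = [] ∷ []
allSubsets (suc n) = map (false ∷_) (allSubsets n) ++ map (true ∷_) (allSubsets n)

isVertex : ∀ {n} → Family n → Fin n → Bool
isVertex X v = X ⁅ v ⁆

del : ∀ {n} → Family n → Fin n → Family n
del X v S = X S ∧ not (lookup S v)

-- lk(X;v) = {T ∈ X : v ∉ T, T ∪ {v} ∈ X}  (T ∪ {v} ∈ X implies T ∈ X)
lk : ∀ {n} → Family n → Fin n → Family n
lk X v T = X T ∧ not (lookup T v) ∧ X (T [ v ]≔ true)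

allB : ∀ {A : Set} → (A → Bool) → List A → Bool
allB p [] = true
allB p (x ∷ xs) = p x ∧ allB p xs

sameFamily : ∀ {n} → Family n → Family n → Bool
sameFamily {n} X Y = allB (λ S → does (X S ≟ᵇ Y S)) (allSubsets n)

isNonCone : ∀ {n} → Family n → Fin n → Bool
isNonCone X v = isVertex X v ∧ not (sameFamily (lk X v) (del X v))

-- minimum of a list of naturals, returning 0 on the empty list
-- (the empty case is exactly V(X)° = ∅, where θ(X) = 0)
minList : List ℕ → ℕ
minList [] = 0
minList (x ∷ xs) = foldr _⊓_ x xs

-- θ with fuel.  Each recursive step removes a vertex (v is no vertex of
-- del(X;v) or lk(X;v)), so fuel n + 1 on Fin n always suffices and the
-- fuel-0 clause is never reached from θ below.
thetaF : ∀ {n} → ℕ → Family n → ℕ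
thetaF zero X = 0
thetaF {n} (suc k) X =
  minList (Data.List.concatMap
    (λ v → if isNonCone X v
           then (thetaF k (del X v) ⊔ suc (thetaF k (lk X v))) ∷ []
           else [])
    (allFinL n))

θ : ∀ {n} → Family n → ℕ
θ {n} X = thetaF (suc n) X

record Graph (m : ℕ) : Set₁ where
  field
    E     : Fin m → Fin m → Set
    sym   : ∀ {u v} → E u v → E v u
    irrefl : ∀ {u} → ¬ E u u
open Graph public

complement : ∀ {m} → Graph m → Graph m
complement G = record
  { E = λ u v → (u ≢ v) × ¬ E G u v
  ; sym = λ { (u≢v , ¬e) → (λ eq → u≢v (Relation.Binary.PropositionalEquality.sym eq))
                           , (λ e → ¬e (Graph.sym G e)) }
  ; irrefl = λ { (u≢u , _) → u≢u Relation.Binary.PropositionalEquality.refl }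
  }

HasEdge : ∀ {m} → Graph m → Set
HasEdge {m} G = Σ (Fin m) λ u → Σ (Fin m) λ v → E G u v

CycAdj : (k : ℕ) → Fin k → Fin k → Set
CycAdj k i j =
  toℕ j ≡ suc (toℕ i) ⊎ toℕ i ≡ suc (toℕ j)
  ⊎ (toℕ i ≡ 0 × toℕ j ≡ k ∸ 1) ⊎ (toℕ j ≡ 0 × toℕ i ≡ k ∸ 1)

InducedCycle : ∀ {m} → Graph m → ℕ → Set
InducedCycle {m} G k =
  Σ (Fin k → Fin m) λ c →
    Injective _≡_ _≡_ c × (∀ i j → E G (c i) (c j) ⇔ CycAdj k i j)

Chordal : ∀ {m} → Graph m → Set
Chordal G = ∀ k → k ≥ 4 → ¬ InducedCycle G k

CoChordal : ∀ {m} → Graph m → Set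
CoChordal G = Chordal (complement G)

Independent : ∀ {m} → Graph m → Subset m → Set
Independent G T = ∀ u v → u ∈ T → v ∈ T → ¬ E G u v

-- X = Ind(G), where G's vertices are identified with vertices of the
-- ground set Fin n via an injective labelling ι : Fin m → Fin n:
-- the faces of X are exactly the images under ι of independent sets of G.
IsIndOf : ∀ {n m} → Family n → Graph m → (Fin m → Fin n) → Set
IsIndOf {n} {m} X G ι =
  Injective _≡_ _≡_ ι ×
  (∀ (S : Subset n) →
     X S ≡ true ⇔
     (Σ (Subset m) λ T → Independent G T × (∀ v → v ∈ S ⇔ (∃ λ i → i ∈ T × ι i ≡ v))))

{-# OPTIONS --safe #-}

-- θ(X) ≤ 1 says that some non-cone vertex v has θ(del(X;v)) ≤ 1 and
-- θ(lk(X;v)) = 0, i.e. lk(X;v) is a simplex.  Adding a vertex whose link is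
-- a simplex keeps a complex flag and only adds a simplicial vertex to its
-- 1-skeleton, so by induction θ(X) ≤ 1 forces X to be a flag complex with
-- chordal 1-skeleton.  Conversely, in such a complex with a non-cone vertex
-- two vertices are non-adjacent, and Dirac's lemma yields a simplicial vertex
-- that is not adjacent to everything: it is a non-cone vertex whose link is a
-- simplex and whose deletion is again flag with chordal 1-skeleton.  Finally
-- a flag complex is the independence complex of the complement of its
-- 1-skeleton, which is co-chordal, and has an edge exactly when X has a
-- non-cone vertex.

module Submission where

open import Defs hiding (sym)

open import Data.Bool using (Bool; true; false; if_then_else_)
open import Data.Bool.Properties using (¬-not) renaming (_≟_ to _≟ᵇ_)
open import Data.Empty using (⊥; ⊥-elim)
open import Data.Fin as Fin using (Fin; zero; suc; toℕ; fromℕ<)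
import Data.Fin.Properties as Fin
open import Data.Fin.Subset using (Subset; _∈_; _∉_; _⊆_; _⊂_; _⊃_; _∪_; ⁅_⁆; _-_; ∣_∣)
  renaming (⊥ to ∅)
import Data.Fin.Subset.Properties as Subset
open import Data.Fin.Subset.Induction using (⊂-wellFounded; ⊃-wellFounded)
open import Data.List as List using (List; []; _∷_; concatMap; length)
open import Data.List.Membership.Propositional using () renaming (_∈_ to _∈ₗ_)
open import Data.List.Membership.Propositional.Properties
  using (∈-allFin; ∈-concatMap⁺; ∈-concatMap⁻; foldr-selective; ∈-++⁺ˡ; ∈-++⁺ʳ; ∈-map⁺;
         ∈-lookup; ∈-filter⁺; ∈-filter⁻)
open import Data.List.Properties using (foldr-preservesᵒ)
open import Data.List.Relation.Unary.All as All using (All; []; _∷_)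
open import Data.List.Relation.Unary.AllPairs using (_∷_)
open import Data.List.Relation.Unary.Any as Any using (here; there)
open import Data.List.Relation.Unary.Any.Properties using (lookup-index)
open import Data.List.Relation.Unary.Unique.Propositional using (Unique)
open import Data.List.Relation.Unary.Unique.Propositional.Properties using (allFin⁺; filter⁺)
open import Data.Nat using (ℕ; zero; suc; _≤_; _<_; z≤n; s≤s; _⊔_; _⊓_; _∸_; _+_)
import Data.Nat.Properties as ℕ
open import Data.Product using (Σ; ∃; ∃₂; _×_; _,_; proj₁; proj₂)
open import Data.Sum as Sum using (_⊎_; inj₁; inj₂; [_,_])
open import Data.Unit using (⊤; tt)
open import Data.Vec using ([]; _∷_; here; there; lookup; _[_]≔_; tabulate)
import Data.Vec.Properties as Vec
open import Function using (_∘_; id; case_of_)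
open import Function.Bundles using (_⇔_; mk⇔; Equivalence)
import Function.Properties.Equivalence as ⇔
open import Function.Definitions using (Injective)
open import Induction.WellFounded using (Acc; acc; WfRec)
import Induction.WellFounded as WF
open import Level using (Level; 0ℓ)
open import Relation.Binary.PropositionalEquality hiding ([_])
open import Relation.Nullary using (¬_; Dec; yes; no; does)
open import Relation.Nullary.Decidable
  using (dec-true; decidable-stable; _×-dec_; _⊎-dec_; _→-dec_; ¬?)
open import Relation.Unary using (Pred; Decidable)

private
  variable
    n m : ℕ
    ℓ : Level

true≢false-elim : ∀ {a} {A : Set a} {b : Bool} → b ≡ true → b ≡ false → A
true≢false-elim refl ()

≢true⇒≡false : {b : Bool} → b ≢ true → b ≡ false
≢true⇒≡false = ¬-not

does⇒ : ∀ {a} {A : Set a} (a? : Dec A) → does a? ≡ true → A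
does⇒ (yes a) _ = a

lookup⇒∈ : {S : Subset n} {x : Fin n} → lookup S x ≡ true → x ∈ S
lookup⇒∈ = Vec.lookup⇒[]= _ _

∉⇒lookup : {S : Subset n} {x : Fin n} → x ∉ S → lookup S x ≡ false
∉⇒lookup x∉S = ≢true⇒≡false (x∉S ∘ lookup⇒∈)

lookup⇒∉ : {S : Subset n} {x : Fin n} → lookup S x ≡ false → x ∉ S
lookup⇒∉ e x∈S = true≢false-elim (Vec.[]=⇒lookup x∈S) e

⁅x⁆⊆ : {S : Subset n} {x : Fin n} → x ∈ S → ⁅ x ⁆ ⊆ S
⁅x⁆⊆ {S = S} x∈S u∈ = subst (_∈ S) (sym (Subset.x∈⁅y⁆⇒x≡y _ u∈)) x∈S

∈-insert-self : (S : Subset n) (v : Fin n) → v ∈ S [ v ]≔ true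
∈-insert-self S v = Vec.[]≔-updates S v

∈-insert⁺ : {S : Subset n} {u : Fin n} (v : Fin n) → u ∈ S → u ∈ S [ v ]≔ true
∈-insert⁺ {S = S} {u} v u∈S with u Fin.≟ v
... | yes refl = ∈-insert-self S v
... | no  u≢v  = Vec.[]≔-minimal S u v u≢v u∈S

∈-insert⁻ : {S : Subset n} {u v : Fin n} → u ∈ S [ v ]≔ true → u ≡ v ⊎ u ∈ S
∈-insert⁻ {S = S} {u} {v} u∈ with u Fin.≟ v
... | yes u≡v = inj₁ u≡v
... | no  u≢v = inj₂ (lookup⇒∈ (trans (sym (Vec.lookup∘update′ u≢v S true)) (Vec.[]=⇒lookup u∈)))

insert-comm : (S : Subset n) (u v : Fin n) → (S [ u ]≔ true) [ v ]≔ true ≡ (S [ v ]≔ true) [ u ]≔ true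
insert-comm S u v with u Fin.≟ v
... | yes refl = refl
... | no  u≢v  = Vec.[]≔-commutes S u v u≢v

∉-remove : (S : Subset n) (v : Fin n) → v ∉ S - v
∉-remove (_ ∷ S) zero    ()
∉-remove (_ ∷ S) (suc v) (there v∈) = ∉-remove S v v∈

∈-remove⁻ : {S : Subset n} {u v : Fin n} → u ∈ S - v → u ∈ S × u ≢ v
∈-remove⁻ {S = S} {v = v} u∈ = Subset.p─q⊆p S ⁅ v ⁆ u∈ , λ { refl → ∉-remove S v u∈ }

remove-insert : {S : Subset n} {v : Fin n} → v ∈ S → (S - v) [ v ]≔ true ≡ S
remove-insert {S = S} {v} v∈S = Subset.⊆-antisym ⊆S S⊆
  where
  ⊆S : (S - v) [ v ]≔ true ⊆ S
  ⊆S u∈ with ∈-insert⁻ u∈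
  ... | inj₁ refl = v∈S
  ... | inj₂ u∈   = Subset.p─q⊆p S ⁅ v ⁆ u∈
  S⊆ : S ⊆ (S - v) [ v ]≔ true
  S⊆ {u} u∈S with u Fin.≟ v
  ... | yes refl = ∈-insert-self (S - v) v
  ... | no  u≢v  = ∈-insert⁺ v (Subset.x∈p∧x≢y⇒x∈p-y u∈S u≢v)

subsetOf : {P : Pred (Fin n) ℓ} → Decidable P → Subset n
subsetOf P? = tabulate (does ∘ P?)

module _ {P : Pred (Fin n) ℓ} (P? : Decidable P) where

  ∈-subsetOf⁺ : ∀ {u} → P u → u ∈ subsetOf P?
  ∈-subsetOf⁺ {u} pu = lookup⇒∈ (trans (Vec.lookup∘tabulate (does ∘ P?) u) (dec-true (P? u) pu))

  ∈-subsetOf⁻ : ∀ {u} → u ∈ subsetOf P? → P u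
  ∈-subsetOf⁻ {u} u∈ = does⇒ (P? u) (trans (sym (Vec.lookup∘tabulate (does ∘ P?) u)) (Vec.[]=⇒lookup u∈))

face-subst : (X : Family n) {S T : Subset n} → S ≡ T → X S ≡ true → X T ≡ true
face-subst X = subst (λ S → X S ≡ true)

module _ (X : Family n) where

  vertex-of-face : IsSimplicialComplex X → ∀ {S u} → X S ≡ true → u ∈ S → X ⁅ u ⁆ ≡ true
  vertex-of-face sc {S} xS u∈S = sc S _ (⁅x⁆⊆ u∈S) xS

  ∅-face : IsSimplicialComplex X → ∀ {S} → X S ≡ true → X ∅ ≡ true
  ∅-face sc {S} = sc S ∅ Subset.⊥⊆

  del-face⁺ : ∀ {v S} → X S ≡ true → v ∉ S → del X v S ≡ true
  del-face⁺ xS v∉S rewrite xS | ∉⇒lookup v∉S = refl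

  del-face⁻ : ∀ {v S} → del X v S ≡ true → X S ≡ true × v ∉ S
  del-face⁻ {v} {S} e with X S | lookup S v in v∈?
  ... | true | false = refl , lookup⇒∉ v∈?

  lk-face⁺ : ∀ {v T} → X T ≡ true → v ∉ T → X (T [ v ]≔ true) ≡ true → lk X v T ≡ true
  lk-face⁺ xT v∉T xTv rewrite xT | ∉⇒lookup v∉T | xTv = refl

  lk-face⁻ : ∀ {v T} → lk X v T ≡ true → X T ≡ true × v ∉ T × X (T [ v ]≔ true) ≡ true
  lk-face⁻ {v} {T} e with X T | lookup T v in v∈? | X (T [ v ]≔ true)
  ... | true | false | true = refl , lookup⇒∉ v∈? , refl

  del-isSimplicialComplex : IsSimplicialComplex X → ∀ v → IsSimplicialComplex (del X v)
  del-isSimplicialComplex sc v S T T⊆S e =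
    let xS , v∉S = del-face⁻ e in del-face⁺ (sc S T T⊆S xS) (v∉S ∘ T⊆S)

IsCone : Family n → Fin n → Set
IsCone X v = ∀ T → X T ≡ true → v ∉ T → X (T [ v ]≔ true) ≡ true

ConeFailure : Family n → Fin n → Set
ConeFailure X v = ∃ λ T → X T ≡ true × v ∉ T × X (T [ v ]≔ true) ≡ false

AllCone : Family n → Set
AllCone X = ∀ v → isNonCone X v ≡ false

failure⇒¬cone : ∀ {X : Family n} {v} → ConeFailure X v → ¬ IsCone X v
failure⇒¬cone (T , xT , v∉T , xTv) cone = true≢false-elim (cone T xT v∉T) xTv

cone-or-failure : (X : Family n) (v : Fin n) → IsCone X v ⊎ ConeFailure X v
cone-or-failure X v with Subset.anySubset? failure?
  where
  failure? : ∀ T → Dec (X T ≡ true × v ∉ T × X (T [ v ]≔ true) ≡ false)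
  failure? T = X T ≟ᵇ true ×-dec ¬? (v Subset.∈? T) ×-dec X (T [ v ]≔ true) ≟ᵇ false
... | yes failure = inj₂ failure
... | no ¬failure = inj₁ λ T xT v∉T → ¬-not (λ xTv → ¬failure (T , xT , v∉T , xTv))

allB-sound : ∀ {A : Set} {p : A → Bool} {xs} → allB p xs ≡ true → ∀ {x} → x ∈ₗ xs → p x ≡ true
allB-sound {p = p} {y ∷ _} e (here refl) with p y | e
... | true | _ = refl
allB-sound {p = p} {y ∷ _} e (there x∈) with p y | e
... | true | e′ = allB-sound e′ x∈

allB-complete : ∀ {A : Set} {p : A → Bool} xs → (∀ {x} → x ∈ₗ xs → p x ≡ true) → allB p xs ≡ true
allB-complete []       _ = refl
allB-complete (y ∷ xs) h rewrite h (here refl) = allB-complete xs (h ∘ there)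

∈-allSubsets : (S : Subset n) → S ∈ₗ allSubsets n
∈-allSubsets []          = here refl
∈-allSubsets (false ∷ S) = ∈-++⁺ˡ (∈-map⁺ (false ∷_) (∈-allSubsets S))
∈-allSubsets (true ∷ S)  = ∈-++⁺ʳ _ (∈-map⁺ (true ∷_) (∈-allSubsets S))

sameFamily⇒≗ : (X Y : Family n) → sameFamily X Y ≡ true → ∀ S → X S ≡ Y S
sameFamily⇒≗ X Y e S = does⇒ (X S ≟ᵇ Y S) (allB-sound {xs = allSubsets _} e (∈-allSubsets S))

≗⇒sameFamily : (X Y : Family n) → (∀ S → X S ≡ Y S) → sameFamily X Y ≡ true
≗⇒sameFamily X Y h = allB-complete (allSubsets _) λ {S} _ → dec-true (X S ≟ᵇ Y S) (h S)

module _ (X : Family n) {v : Fin n} where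

  cone⇒lk≗del : IsCone X v → ∀ T → lk X v T ≡ del X v T
  cone⇒lk≗del cone T with X T in xT | lookup T v in v∈?
  ... | false | _     = refl
  ... | true  | true  = refl
  ... | true  | false rewrite cone T xT (lookup⇒∉ v∈?) = refl

  lk≗del⇒cone : (∀ T → lk X v T ≡ del X v T) → IsCone X v
  lk≗del⇒cone h T xT v∉T = proj₂ (proj₂ (lk-face⁻ X (trans (h T) (del-face⁺ X xT v∉T))))

  isNonCone⇔ : isNonCone X v ≡ true ⇔ (X ⁅ v ⁆ ≡ true × ¬ IsCone X v)
  isNonCone⇔ = mk⇔ to from
    where
    to : isNonCone X v ≡ true → X ⁅ v ⁆ ≡ true × ¬ IsCone X v
    to e with X ⁅ v ⁆ | sameFamily (lk X v) (del X v) in same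
    ... | true | false = refl , λ cone → true≢false-elim (≗⇒sameFamily _ _ (cone⇒lk≗del cone)) same
    from : X ⁅ v ⁆ ≡ true × ¬ IsCone X v → isNonCone X v ≡ true
    from (xv , ¬cone) rewrite xv with sameFamily (lk X v) (del X v) in same
    ... | true  = ⊥-elim (¬cone (lk≗del⇒cone (sameFamily⇒≗ _ _ same)))
    ... | false = refl

  isNonCone⇒vertex : isNonCone X v ≡ true → X ⁅ v ⁆ ≡ true
  isNonCone⇒vertex = proj₁ ∘ Equivalence.to isNonCone⇔

  failure⇒isNonCone : X ⁅ v ⁆ ≡ true → ConeFailure X v → isNonCone X v ≡ true
  failure⇒isNonCone xv failure = Equivalence.from isNonCone⇔ (xv , failure⇒¬cone failure)

  ¬isNonCone⇒cone : X ⁅ v ⁆ ≡ true → isNonCone X v ≡ false → IsCone X v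
  ¬isNonCone⇒cone xv e with cone-or-failure X v
  ... | inj₁ cone    = cone
  ... | inj₂ failure = true≢false-elim (failure⇒isNonCone xv failure) e

allCone-simplex : (X : Family n) → X ∅ ≡ true → AllCone X →
  ∀ S → (∀ {u} → u ∈ S → X ⁅ u ⁆ ≡ true) → X S ≡ true
allCone-simplex X x∅ allCone = WF.All.wfRec ⊂-wellFounded 0ℓ P step
  where
  P : Subset _ → Set
  P S = (∀ {u} → u ∈ S → X ⁅ u ⁆ ≡ true) → X S ≡ true
  step : ∀ S → WfRec _⊂_ P S → P S
  step S rec vertex with Subset.nonempty? S
  ... | no empty = face-subst X (sym (Subset.Empty-unique empty)) x∅
  ... | yes (v , v∈S) = face-subst X (remove-insert v∈S)
    (¬isNonCone⇒cone X (vertex v∈S) (allCone v) (S - v)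
      (rec (Subset.x∈p⇒p-x⊂p v∈S) (vertex ∘ Subset.p─q⊆p S ⁅ v ⁆)) (∉-remove S v))

θ-step : ℕ → Family n → Fin n → ℕ
θ-step k X v = thetaF k (del X v) ⊔ suc (thetaF k (lk X v))

candidates : ℕ → Family n → List ℕ
candidates {n} k X = concatMap (λ v → if isNonCone X v then θ-step k X v ∷ [] else []) (List.allFin n)

minList-≤ : ∀ {z zs} → z ∈ₗ zs → minList zs ≤ z
minList-≤ {z} {x ∷ xs} z∈ = foldr-preservesᵒ pres x xs (from-∈ z∈)
  where
  pres : ∀ a b → a ≤ z ⊎ b ≤ z → a ⊓ b ≤ z
  pres a b (inj₁ a≤z) = ℕ.m≤n⇒m⊓o≤n b a≤z
  pres a b (inj₂ b≤z) = ℕ.m≤n⇒o⊓m≤n a b≤z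
  from-∈ : z ∈ₗ x ∷ xs → x ≤ z ⊎ Any.Any (_≤ z) xs
  from-∈ (here refl)  = inj₁ ℕ.≤-refl
  from-∈ (there z∈xs) = inj₂ (Any.map (λ { refl → ℕ.≤-refl }) z∈xs)

minList-∈ : ∀ zs → zs ≡ [] ⊎ minList zs ∈ₗ zs
minList-∈ []       = inj₁ refl
minList-∈ (x ∷ xs) with foldr-selective ℕ.⊓-sel x xs
... | inj₁ min≡x  = inj₂ (here min≡x)
... | inj₂ min∈xs = inj₂ (there min∈xs)

module _ (k : ℕ) (X : Family n) where

  private
    candidates-at : Fin n → List ℕ
    candidates-at v = if isNonCone X v then θ-step k X v ∷ [] else []

  ∈-candidates⁺ : ∀ {v} → isNonCone X v ≡ true → θ-step k X v ∈ₗ candidates k X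
  ∈-candidates⁺ {v} e = ∈-concatMap⁺ candidates-at (Any.map (λ { refl → chosen }) (∈-allFin v))
    where
    chosen : θ-step k X v ∈ₗ candidates-at v
    chosen rewrite e = here refl

  ∈-candidates⁻ : ∀ {z} → z ∈ₗ candidates k X → ∃ λ v → isNonCone X v ≡ true × z ≡ θ-step k X v
  ∈-candidates⁻ z∈ with Any.satisfied (∈-concatMap⁻ candidates-at {xs = List.allFin n} z∈)
  ... | v , z∈v with isNonCone X v in e | z∈v
  ...   | true | here z≡ = v , e , z≡

  thetaF-cases : (AllCone X × thetaF (suc k) X ≡ 0) ⊎
                 ∃ λ v → isNonCone X v ≡ true × thetaF (suc k) X ≡ θ-step k X v
  thetaF-cases with minList-∈ (candidates k X)
  ... | inj₂ min∈  = inj₂ (∈-candidates⁻ min∈)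
  ... | inj₁ empty = inj₁ (allCone , cong minList empty)
    where
    allCone : AllCone X
    allCone v = ≢true⇒≡false λ e → case subst (θ-step k X v ∈ₗ_) empty (∈-candidates⁺ e) of λ ()

  thetaF-≤-step : ∀ {v} → isNonCone X v ≡ true → thetaF (suc k) X ≤ θ-step k X v
  thetaF-≤-step e = minList-≤ (∈-candidates⁺ e)

  thetaF-positive : ∀ {v} → isNonCone X v ≡ true → 1 ≤ thetaF (suc k) X
  thetaF-positive {v} e with thetaF-cases
  ... | inj₁ (allCone , _) = true≢false-elim e (allCone v)
  ... | inj₂ (w , _ , θ≡) = subst (1 ≤_) (sym θ≡) (ℕ.≤-trans (s≤s z≤n) (ℕ.m≤n⊔m _ _))

thetaF-allCone : ∀ k {X : Family n} → AllCone X → thetaF k X ≡ 0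
thetaF-allCone zero    allCone = refl
thetaF-allCone (suc k) {X} allCone with thetaF-cases k X
... | inj₁ (_ , θ≡0)    = θ≡0
... | inj₂ (v , e , _) = true≢false-elim e (allCone v)

-- thetaF k X is θ(X) only when k exceeds the number of vertices of X (fuel 0
-- returns 0), so the inductions on θ below carry ∣ vertexSet X ∣ < k.
vertexSet : Family n → Subset n
vertexSet X = subsetOf (λ u → X ⁅ u ⁆ ≟ᵇ true)

∈-vertexSet⁺ : (X : Family n) {u : Fin n} → X ⁅ u ⁆ ≡ true → u ∈ vertexSet X
∈-vertexSet⁺ X = ∈-subsetOf⁺ (λ u → X ⁅ u ⁆ ≟ᵇ true)

∈-vertexSet⁻ : (X : Family n) {u : Fin n} → u ∈ vertexSet X → X ⁅ u ⁆ ≡ true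
∈-vertexSet⁻ X = ∈-subsetOf⁻ (λ u → X ⁅ u ⁆ ≟ᵇ true)

module _ (X : Family n) {v : Fin n} (xv : X ⁅ v ⁆ ≡ true) where

  vertexSet-del⊂ : vertexSet (del X v) ⊂ vertexSet X
  vertexSet-del⊂ = ∈-vertexSet⁺ X ∘ proj₁ ∘ del-face⁻ X ∘ ∈-vertexSet⁻ (del X v)
                , v , ∈-vertexSet⁺ X xv
                , λ v∈ → proj₂ (del-face⁻ X (∈-vertexSet⁻ (del X v) v∈)) (Subset.x∈⁅x⁆ v)

  vertexSet-lk⊂ : vertexSet (lk X v) ⊂ vertexSet X
  vertexSet-lk⊂ = ∈-vertexSet⁺ X ∘ proj₁ ∘ lk-face⁻ X ∘ ∈-vertexSet⁻ (lk X v)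
               , v , ∈-vertexSet⁺ X xv
               , λ v∈ → proj₁ (proj₂ (lk-face⁻ X (∈-vertexSet⁻ (lk X v) v∈))) (Subset.x∈⁅x⁆ v)

  fuel-del : ∀ {k} → ∣ vertexSet X ∣ < suc k → ∣ vertexSet (del X v) ∣ < k
  fuel-del lt = ℕ.<-≤-trans (Subset.p⊂q⇒∣p∣<∣q∣ vertexSet-del⊂) (ℕ.≤-pred lt)

  fuel-lk : ∀ {k} → ∣ vertexSet X ∣ < suc k → ∣ vertexSet (lk X v) ∣ < k
  fuel-lk lt = ℕ.<-≤-trans (Subset.p⊂q⇒∣p∣<∣q∣ vertexSet-lk⊂) (ℕ.≤-pred lt)

fuel-θ : (X : Family n) → ∣ vertexSet X ∣ < suc n
fuel-θ X = s≤s (Subset.∣p∣≤n (vertexSet X))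

thetaF≡0⇒allCone : ∀ {k} {X : Family n} → ∣ vertexSet X ∣ < k → thetaF k X ≡ 0 → AllCone X
thetaF≡0⇒allCone {k = suc k} {X} _ θ≡0 v =
  ≢true⇒≡false λ e → case subst (1 ≤_) θ≡0 (thetaF-positive k X e) of λ ()

-- Induced cycles and chordality

CycAdj-sym : ∀ {k} {i j : Fin k} → CycAdj k i j → CycAdj k j i
CycAdj-sym (inj₁ e)               = inj₂ (inj₁ e)
CycAdj-sym (inj₂ (inj₁ e))        = inj₁ e
CycAdj-sym (inj₂ (inj₂ (inj₁ e))) = inj₂ (inj₂ (inj₂ e))
CycAdj-sym (inj₂ (inj₂ (inj₂ e))) = inj₂ (inj₂ (inj₁ e))

private
  CycAdjℕ : ℕ → ℕ → ℕ → Set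
  CycAdjℕ k a b = b ≡ suc a ⊎ a ≡ suc b ⊎ (a ≡ 0 × b ≡ k ∸ 1) ⊎ (b ≡ 0 × a ≡ k ∸ 1)

  n≢1+n : ∀ n → n ≢ suc n
  n≢1+n n = ℕ.<⇒≢ (ℕ.n<1+n n)

  n≢2+n : ∀ n → n ≢ suc (suc n)
  n≢2+n n = ℕ.<⇒≢ (ℕ.m<n⇒m<1+n (ℕ.n<1+n n))

  n≢3+n : ∀ n → n ≢ suc (suc (suc n))
  n≢3+n n = ℕ.<⇒≢ (ℕ.m<n⇒m<1+n (ℕ.m<n⇒m<1+n (ℕ.n<1+n n)))

  neighboursℕ : ∀ r a → a < 4 + r → ∃₂ λ b₁ b₂ → b₁ < 4 + r × b₂ < 4 + r ×
    CycAdjℕ (4 + r) a b₁ × CycAdjℕ (4 + r) a b₂ × b₁ ≢ b₂ × ¬ CycAdjℕ (4 + r) b₁ b₂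
  neighboursℕ r zero _ =
    1 , 3 + r , s≤s (s≤s z≤n) , ℕ.≤-refl , inj₁ refl , inj₂ (inj₂ (inj₁ (refl , refl))) ,
    (λ ()) , not-adjacent
    where
    not-adjacent : ¬ CycAdjℕ (4 + r) 1 (3 + r)
    not-adjacent (inj₁ ())
    not-adjacent (inj₂ (inj₁ ()))
    not-adjacent (inj₂ (inj₂ (inj₁ (() , _))))
    not-adjacent (inj₂ (inj₂ (inj₂ (() , _))))
  neighboursℕ r (suc a) a<k with suc a ℕ.≟ 3 + r
  ... | yes last =
    a , 0 , ℕ.<-trans (ℕ.n<1+n a) a<k , s≤s z≤n , inj₂ (inj₁ refl) , inj₂ (inj₂ (inj₂ (refl , last))) ,
    (λ a≡0 → case trans (sym a≡0) a≡2+r of λ ()) , not-adjacent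
    where
    a≡2+r : a ≡ 2 + r
    a≡2+r = ℕ.suc-injective last
    not-adjacent : ¬ CycAdjℕ (4 + r) a 0
    not-adjacent (inj₁ ())
    not-adjacent (inj₂ (inj₁ a≡1)) = case trans (sym a≡1) a≡2+r of λ ()
    not-adjacent (inj₂ (inj₂ (inj₁ (_ , ()))))
    not-adjacent (inj₂ (inj₂ (inj₂ (_ , a≡3+r)))) = n≢1+n (2 + r) (trans (sym a≡2+r) a≡3+r)
  ... | no ¬last =
    a , 2 + a , ℕ.<-trans (ℕ.n<1+n a) a<k , 2+a<k , inj₂ (inj₁ refl) , inj₁ refl , n≢2+n a , not-adjacent
    where
    2+a<k : 2 + a < 4 + r
    2+a<k with ℕ.m≤n⇒m<n∨m≡n (ℕ.≤-pred a<k)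
    ... | inj₁ lt  = s≤s lt
    ... | inj₂ eq  = ⊥-elim (¬last eq)
    not-adjacent : ¬ CycAdjℕ (4 + r) a (2 + a)
    not-adjacent (inj₁ e)               = n≢1+n (suc a) (sym e)
    not-adjacent (inj₂ (inj₁ e))        = n≢3+n a e
    not-adjacent (inj₂ (inj₂ (inj₁ (refl , ()))))
    not-adjacent (inj₂ (inj₂ (inj₂ (() , _))))

cycle-neighbours : ∀ {k} → 4 ≤ k → (i : Fin k) →
  ∃₂ λ j₁ j₂ → CycAdj k i j₁ × CycAdj k i j₂ × j₁ ≢ j₂ × ¬ CycAdj k j₁ j₂
cycle-neighbours {suc (suc (suc (suc r)))} (s≤s (s≤s (s≤s (s≤s _)))) i
  with neighboursℕ r (toℕ i) (Fin.toℕ<n i)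
... | b₁ , b₂ , b₁<k , b₂<k , i~b₁ , i~b₂ , b₁≢b₂ , b₁≁b₂ =
  fromℕ< b₁<k , fromℕ< b₂<k ,
  subst (CycAdjℕ (4 + r) (toℕ i)) (sym e₁) i~b₁ , subst (CycAdjℕ (4 + r) (toℕ i)) (sym e₂) i~b₂ ,
  (λ eq → b₁≢b₂ (trans (sym e₁) (trans (cong toℕ eq) e₂))) ,
  (λ adj → b₁≁b₂ (subst₂ (CycAdjℕ (4 + r)) e₁ e₂ adj))
  where
  e₁ : toℕ (fromℕ< b₁<k) ≡ b₁
  e₁ = Fin.toℕ-fromℕ< b₁<k
  e₂ : toℕ (fromℕ< b₂<k) ≡ b₂
  e₂ = Fin.toℕ-fromℕ< b₂<k

cycle-neighbour : ∀ {k} → 4 ≤ k → (i : Fin k) → ∃ λ j → CycAdj k i j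
cycle-neighbour k≥4 i = let j₁ , _ , i~j₁ , _ = cycle-neighbours k≥4 i in j₁ , i~j₁

module _ (G : Graph n) where

  IsClique : Subset n → Set
  IsClique K = ∀ {a b} → a ∈ K → b ∈ K → a ≢ b → E G a b

  singleton-clique : ∀ v → IsClique ⁅ v ⁆
  singleton-clique v a∈ b∈ a≢b = ⊥-elim (a≢b (trans (Subset.x∈⁅y⁆⇒x≡y v a∈) (sym (Subset.x∈⁅y⁆⇒x≡y v b∈))))

  Simplicial : Subset n → Fin n → Set
  Simplicial U v = ∀ {a b} → a ∈ U → b ∈ U → E G v a → E G v b → a ≢ b → E G a b

  CliqueNeighbourhood : Fin n → Set
  CliqueNeighbourhood v = ∀ {a b} → E G v a → E G v b → a ≢ b → E G a b

  simplicial-∉-cycle : ∀ {k} → 4 ≤ k → (cycle : InducedCycle G k) → ∀ i →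
    ¬ CliqueNeighbourhood (proj₁ cycle i)
  simplicial-∉-cycle k≥4 (c , c-inj , c-adj) i simplicial
    with cycle-neighbours k≥4 i
  ... | j₁ , j₂ , i~j₁ , i~j₂ , j₁≢j₂ , j₁≁j₂ =
    j₁≁j₂ (Equivalence.to (c-adj j₁ j₂)
      (simplicial (Equivalence.from (c-adj i j₁) i~j₁) (Equivalence.from (c-adj i j₂) i~j₂)
                  (j₁≢j₂ ∘ c-inj)))

Chordal-resp : {G H : Graph n} → (∀ u v → E G u v ⇔ E H u v) → Chordal G → Chordal H
Chordal-resp G⇔H chordal k k≥4 (c , c-inj , c-adj) =
  chordal k k≥4 (c , c-inj , λ i j → ⇔.trans (G⇔H (c i) (c j)) (c-adj i j))

comap : (Fin m → Fin n) → Graph n → Graph m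
comap ι G = record
  { E      = λ i j → E G (ι i) (ι j)
  ; sym    = Graph.sym G
  ; irrefl = Graph.irrefl G
  }

Chordal-comap : {G : Graph n} {ι : Fin m → Fin n} → Injective _≡_ _≡_ ι → Chordal G → Chordal (comap ι G)
Chordal-comap ι-inj chordal k k≥4 (c , c-inj , c-adj) = chordal k k≥4 (_ , c-inj ∘ ι-inj , c-adj)

-- Every vertex of a long cycle lies on an edge, so the cycle lifts along ι.
Chordal-comap⁻ : {G : Graph n} {ι : Fin m → Fin n} → (∀ {u v} → E G u v → ∃ λ i → ι i ≡ u) →
  Chordal (comap ι G) → Chordal G
Chordal-comap⁻ {G = G} {ι} covered chordal k k≥4 (c , c-inj , c-adj) =
  chordal k k≥4 (lift , lift-inj , λ i j → subst (_⇔ CycAdj k i j) (sym (E-lift i j)) (c-adj i j))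
  where
  preimage : ∀ i → ∃ λ i′ → ι i′ ≡ c i
  preimage i = let j , i~j = cycle-neighbour k≥4 i in covered (Equivalence.from (c-adj i j) i~j)
  lift : Fin k → Fin _
  lift = proj₁ ∘ preimage
  lift-inj : Injective _≡_ _≡_ lift
  lift-inj {i} {j} eq = c-inj (trans (sym (proj₂ (preimage i))) (trans (cong ι eq) (proj₂ (preimage j))))
  E-lift : ∀ i j → E G (ι (lift i)) (ι (lift j)) ≡ E G (c i) (c j)
  E-lift i j = cong₂ (E G) (proj₂ (preimage i)) (proj₂ (preimage j))

-- Chordless walks

module Walks (G : Graph n) where

  data Walk (P : Pred (Fin n) 0ℓ) : Fin n → Fin n → Set where
    [_]ʷ   : ∀ {a} → P a → Walk P a a
    _∷⟨_⟩_ : ∀ {a b c} → P a → E G a b → Walk P b c → Walk P a c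

  -- Defining vertices through inner makes the start vertex the head of
  -- vertices w definitionally, which the indexing below relies on.
  vertices : ∀ {P a b} → Walk P a b → List (Fin n)
  inner    : ∀ {P a b} → Walk P a b → List (Fin n)
  vertices {a = a} w = a ∷ inner w
  inner [ _ ]ʷ       = []
  inner (_ ∷⟨ _ ⟩ w) = vertices w

  module _ {P : Pred (Fin n) 0ℓ} where

    walk-∈ : ∀ {a b z} (w : Walk P a b) → z ∈ₗ vertices w → P z
    walk-∈ [ pa ]ʷ        (here refl) = pa
    walk-∈ (pa ∷⟨ _ ⟩ _) (here refl) = pa
    walk-∈ (_ ∷⟨ _ ⟩ w)  (there z∈)  = walk-∈ w z∈

    walk-map : ∀ {Q : Pred (Fin n) 0ℓ} {a b} → (∀ {u} → P u → Q u) → Walk P a b → Walk Q a b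
    walk-map f [ pa ]ʷ        = [ f pa ]ʷ
    walk-map f (pa ∷⟨ e ⟩ w) = f pa ∷⟨ e ⟩ walk-map f w

    walk-snoc : ∀ {a b c} → Walk P a b → E G b c → P c → Walk P a c
    walk-snoc [ pa ]ʷ        e  pc = pa ∷⟨ e ⟩ [ pc ]ʷ
    walk-snoc (pa ∷⟨ e ⟩ w) e′ pc = pa ∷⟨ e ⟩ walk-snoc w e′ pc

    walk-reverse : ∀ {a b} → Walk P a b → Walk P b a
    walk-reverse [ pa ]ʷ        = [ pa ]ʷ
    walk-reverse (pa ∷⟨ e ⟩ w) = walk-snoc (walk-reverse w) (Graph.sym G e) pa

    _++ʷ_ : ∀ {a b c} → Walk P a b → Walk P b c → Walk P a c
    [ _ ]ʷ        ++ʷ w′ = w′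
    (pa ∷⟨ e ⟩ w) ++ʷ w′ = pa ∷⟨ e ⟩ (w ++ʷ w′)

    Chordless : ∀ {a b} → Walk P a b → Set
    Chordless [ _ ]ʷ                = ⊤
    Chordless (_∷⟨_⟩_ {a} _ _ w) = (∀ {z} → z ∈ₗ inner w → a ≢ z × ¬ E G a z) × Chordless w

    module _ {R : Pred (Fin n) 0ℓ} (R? : Decidable R) where

      data FinalSegment {a b} (w : Walk P a b) : Set where
        segment : ∀ {z} (s : Walk P z b) → R z → All (¬_ ∘ R) (inner s) →
                  (Chordless w → Chordless s) → FinalSegment w

      last-match : ∀ {a b} (w : Walk P a b) → All (¬_ ∘ R) (vertices w) ⊎ FinalSegment w
      last-match {a} [ pa ]ʷ with R? a
      ... | yes ra = inj₂ (segment [ pa ]ʷ ra [] (λ c → c))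
      ... | no ¬ra = inj₁ (¬ra ∷ [])
      last-match {a} (pa ∷⟨ e ⟩ w) with last-match w
      ... | inj₂ (segment s rz later ch) = inj₂ (segment s rz later (ch ∘ proj₂))
      ... | inj₁ none with R? a
      ...   | yes ra = inj₂ (segment (pa ∷⟨ e ⟩ w) ra none (λ c → c))
      ...   | no ¬ra = inj₁ (¬ra ∷ none)

    -- Prepending a to a chordless walk, jump straight to the last vertex
    -- of the walk that is a or a neighbour of a.
    shortcut : (∀ u v → Dec (E G u v)) → ∀ {a b} → Walk P a b → Σ (Walk P a b) Chordless
    shortcut E? [ pa ]ʷ = [ pa ]ʷ , tt
    shortcut E? (_∷⟨_⟩_ {a} pa e w) with shortcut E? w
    ... | q , q-chordless with last-match (λ z → a Fin.≟ z ⊎-dec E? a z) q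
    ...   | inj₁ (¬head ∷ _) = ⊥-elim (¬head (inj₂ e))
    ...   | inj₂ (segment s (inj₁ refl) _ ch) = s , ch q-chordless
    ...   | inj₂ (segment s (inj₂ a∼z) later ch) =
      pa ∷⟨ a∼z ⟩ s , (λ z∈ → let ¬R = All.lookup later z∈ in ¬R ∘ inj₁ , ¬R ∘ inj₂) , ch q-chordless

    private
      Consecutive : ∀ {k} → Fin k → Fin k → Set
      Consecutive i j = toℕ j ≡ suc (toℕ i) ⊎ toℕ i ≡ suc (toℕ j)

      head-adjacent : ∀ {a b} (w : Walk P a b) → Chordless w → ∀ j →
        E G a (List.lookup (vertices w) j) ⇔ Consecutive zero j
      head-adjacent [ _ ]ʷ       _ zero = mk⇔ (⊥-elim ∘ Graph.irrefl G) λ { (inj₁ ()) ; (inj₂ ()) }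
      head-adjacent (_ ∷⟨ _ ⟩ _) _ zero = mk⇔ (⊥-elim ∘ Graph.irrefl G) λ { (inj₁ ()) ; (inj₂ ()) }
      head-adjacent (_ ∷⟨ e ⟩ _) _ (suc zero) = mk⇔ (λ _ → inj₁ refl) (λ _ → e)
      head-adjacent (_ ∷⟨ _ ⟩ _) (chords , _) (suc (suc j)) =
        mk⇔ (⊥-elim ∘ proj₂ (chords (∈-lookup j))) λ { (inj₁ ()) ; (inj₂ ()) }

      head-injective : ∀ {a b} (w : Walk P a b) → Chordless w → ∀ j → a ≡ List.lookup (vertices w) j → zero ≡ j
      head-injective _            _            zero          _   = refl
      head-injective (_ ∷⟨ e ⟩ _) _            (suc zero)    a≡b =
        ⊥-elim (Graph.irrefl G (subst (E G _) (sym a≡b) e))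
      head-injective (_ ∷⟨ _ ⟩ _) (chords , _) (suc (suc j)) eq  = ⊥-elim (proj₁ (chords (∈-lookup j)) eq)

    chordless-adjacent : ∀ {a b} (w : Walk P a b) → Chordless w → ∀ i j →
      E G (List.lookup (vertices w) i) (List.lookup (vertices w) j) ⇔ Consecutive i j
    chordless-adjacent w c zero j = head-adjacent w c j
    chordless-adjacent w c (suc i) zero =
      let i⇔ = head-adjacent w c (suc i) in
      mk⇔ (Sum.swap ∘ Equivalence.to i⇔ ∘ Graph.sym G) (Graph.sym G ∘ Equivalence.from i⇔ ∘ Sum.swap)
    chordless-adjacent (_ ∷⟨ _ ⟩ w) (_ , c) (suc i) (suc j) =
      ⇔.trans (chordless-adjacent w c i j)
              (mk⇔ (Sum.map (cong suc) (cong suc)) (Sum.map ℕ.suc-injective ℕ.suc-injective))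

    chordless-injective : ∀ {a b} (w : Walk P a b) → Chordless w → Injective _≡_ _≡_ (List.lookup (vertices w))
    chordless-injective w c {zero} {j} eq = head-injective w c j eq
    chordless-injective w c {suc i} {zero} eq = sym (head-injective w c (suc i) (sym eq))
    chordless-injective (_ ∷⟨ _ ⟩ w) (_ , c) {suc i} {suc j} eq = cong suc (chordless-injective w c eq)

    last-vertex : ∀ {a b} (w : Walk P a b) →
      ∃ λ j → suc (toℕ j) ≡ length (vertices w) × List.lookup (vertices w) j ≡ b
    last-vertex [ _ ]ʷ       = zero , refl , refl
    last-vertex (_ ∷⟨ _ ⟩ w) = let j , len , look = last-vertex w in suc j , cong suc len , look

    chordless-long : ∀ {a b} (w : Walk P a b) → a ≢ b → ¬ E G a b → 3 ≤ length (vertices w)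
    chordless-long [ _ ]ʷ                  a≢b _   = ⊥-elim (a≢b refl)
    chordless-long (_ ∷⟨ e ⟩ [ _ ]ʷ)       _   a≁b = ⊥-elim (a≁b e)
    chordless-long (_ ∷⟨ _ ⟩ (_ ∷⟨ _ ⟩ _)) _   _   = s≤s (s≤s (s≤s z≤n))

    module _ {a b} (w : Walk P a b) (chordless : Chordless w) {x : Fin n}
             (x∼a : E G x a) (x∼b : E G x b) (x∉w : ∀ {z} → z ∈ₗ vertices w → x ≢ z)
             (x≁inner : ∀ {z} → z ∈ₗ vertices w → z ≢ a → z ≢ b → ¬ E G x z) where

      private
        L : ℕ
        L = length (vertices w)

        x-adjacent : ∀ j → E G x (List.lookup (vertices w) j) ⇔ CycAdj (suc L) zero (suc j)
        x-adjacent j = mk⇔ to from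
          where
          last : ∃ λ jₗ → suc (toℕ jₗ) ≡ L × List.lookup (vertices w) jₗ ≡ b
          last = last-vertex w
          to : E G x (List.lookup (vertices w) j) → CycAdj (suc L) zero (suc j)
          to x∼z with List.lookup (vertices w) j Fin.≟ a | List.lookup (vertices w) j Fin.≟ b
          ... | yes z≡a | _ = inj₁ (cong (suc ∘ toℕ) (chordless-injective w chordless {j} {zero} z≡a))
          ... | no _ | yes z≡b = inj₂ (inj₂ (inj₁ (refl ,
                trans (cong (suc ∘ toℕ) (chordless-injective w chordless (trans z≡b (sym (proj₂ (proj₂ last))))))
                      (proj₁ (proj₂ last)))))
          ... | no z≢a | no z≢b = ⊥-elim (x≁inner (∈-lookup j) z≢a z≢b x∼z)
          from : CycAdj (suc L) zero (suc j) → E G x (List.lookup (vertices w) j)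
          from (inj₁ 1+j≡1) =
            subst (E G x ∘ List.lookup (vertices w)) (sym (Fin.toℕ-injective (ℕ.suc-injective 1+j≡1))) x∼a
          from (inj₂ (inj₂ (inj₁ (_ , 1+j≡L)))) =
            subst (E G x) (sym (trans (cong (List.lookup (vertices w)) j≡jₗ) (proj₂ (proj₂ last)))) x∼b
            where
            j≡jₗ : j ≡ proj₁ last
            j≡jₗ = Fin.toℕ-injective (ℕ.suc-injective (trans 1+j≡L (sym (proj₁ (proj₂ last)))))
          from (inj₂ (inj₁ ()))
          from (inj₂ (inj₂ (inj₂ (() , _))))

        adjacent : ∀ i j →
          E G (List.lookup (x ∷ vertices w) i) (List.lookup (x ∷ vertices w) j) ⇔ CycAdj (suc L) i j
        adjacent zero zero = mk⇔ (⊥-elim ∘ Graph.irrefl G) λ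
          { (inj₁ ()) ; (inj₂ (inj₁ ())) ; (inj₂ (inj₂ (inj₁ (_ , ())))) ; (inj₂ (inj₂ (inj₂ (_ , ())))) }
        adjacent zero (suc j) = x-adjacent j
        adjacent (suc i) zero =
          mk⇔ (CycAdj-sym ∘ Equivalence.to (x-adjacent i) ∘ Graph.sym G)
              (Graph.sym G ∘ Equivalence.from (x-adjacent i) ∘ CycAdj-sym)
        adjacent (suc i) (suc j) = ⇔.trans (chordless-adjacent w chordless i j) (mk⇔ to from)
          where
          to : Consecutive i j → CycAdj (suc L) (suc i) (suc j)
          to (inj₁ e) = inj₁ (cong suc e)
          to (inj₂ e) = inj₂ (inj₁ (cong suc e))
          from : CycAdj (suc L) (suc i) (suc j) → Consecutive i j
          from (inj₁ e)        = inj₁ (ℕ.suc-injective e)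
          from (inj₂ (inj₁ e)) = inj₂ (ℕ.suc-injective e)
          from (inj₂ (inj₂ (inj₁ (() , _))))
          from (inj₂ (inj₂ (inj₂ (() , _))))

        injective : Injective _≡_ _≡_ (List.lookup (x ∷ vertices w))
        injective {zero}  {zero}  _  = refl
        injective {zero}  {suc j} eq = ⊥-elim (x∉w (∈-lookup j) eq)
        injective {suc i} {zero}  eq = ⊥-elim (x∉w (∈-lookup i) (sym eq))
        injective {suc i} {suc j} eq = cong suc (chordless-injective w chordless eq)

      closing-cycle : InducedCycle G (suc L)
      closing-cycle = List.lookup (x ∷ vertices w) , injective , adjacent

-- Dirac's lemma

module _ (G : Graph n) (E? : ∀ u v → Dec (E G u v)) where

  open Walks G

  record Component (W : Pred (Fin n) 0ℓ) (y : Fin n) : Set where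
    field
      members   : Subset n
      root      : y ∈ members
      ⊆W        : ∀ {u} → u ∈ members → W u
      closed    : ∀ {c u} → c ∈ members → W u → E G c u → u ∈ members
      connected : ∀ {u} → u ∈ members → Walk (_∈ members) y u

  component : ∀ {W : Pred (Fin n) 0ℓ} → Decidable W → ∀ {y} → W y → Component W y
  component {W} W? {y} Wy = grow ⁅ y ⁆ (⊃-wellFounded ⁅ y ⁆) (Subset.x∈⁅x⁆ y)
    (λ u∈ → subst W (sym (Subset.x∈⁅y⁆⇒x≡y y u∈)) Wy)
    (λ u∈ → subst (Walk _ y) (sym (Subset.x∈⁅y⁆⇒x≡y y u∈)) [ Subset.x∈⁅x⁆ y ]ʷ)
    where
    grow : ∀ R → Acc _⊃_ R → y ∈ R → (∀ {u} → u ∈ R → W u) →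
           (∀ {u} → u ∈ R → Walk (_∈ R) y u) → Component W y
    grow R (acc rec) y∈R R⊆W conn
      with Fin.any? (λ u → W? u ×-dec ¬? (u Subset.∈? R) ×-dec
                           Fin.any? (λ c → c Subset.∈? R ×-dec E? c u))
    ... | yes (u , Wu , u∉R , c , c∈R , c∼u) =
      grow (R [ u ]≔ true) (rec (∈-insert⁺ u , u , ∈-insert-self R u , u∉R)) (∈-insert⁺ u y∈R) ⊆W′ conn′
      where
      ⊆W′ : ∀ {u′} → u′ ∈ R [ u ]≔ true → W u′
      ⊆W′ u′∈ with ∈-insert⁻ u′∈
      ... | inj₁ refl = Wu
      ... | inj₂ u′∈R = R⊆W u′∈R
      conn′ : ∀ {u′} → u′ ∈ R [ u ]≔ true → Walk (_∈ R [ u ]≔ true) y u′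
      conn′ u′∈ with ∈-insert⁻ u′∈
      ... | inj₁ refl = walk-snoc (walk-map (∈-insert⁺ u) (conn c∈R)) c∼u (∈-insert-self R u)
      ... | inj₂ u′∈R = walk-map (∈-insert⁺ u) (conn u′∈R)
    ... | no stuck = record
      { members = R ; root = y∈R ; ⊆W = R⊆W ; connected = conn
      ; closed  = λ {c} {u} c∈R Wu c∼u →
          decidable-stable (u Subset.∈? R) (λ u∉R → stuck (u , Wu , u∉R , c , c∈R , c∼u))
      }

  Dominates : Subset n → Fin n → Set
  Dominates K x = ∀ y → y ∈ K → y ≡ x ⊎ E G x y

  Universal : Subset n → Fin n → Set
  Universal U x = ∀ {y} → y ∈ U → y ≢ x → E G x y

  SimplicialOutside : Subset n → Subset n → Set
  SimplicialOutside U K = ∃ λ v → v ∈ U × v ∉ K × Simplicial G U v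

  SimplicialOutsideCliques : Subset n → Set
  SimplicialOutsideCliques U =
    ∀ {K} → K ⊆ U → IsClique G K → ∀ {u₀} → u₀ ∈ U → u₀ ∉ K → SimplicialOutside U K

  Far : Subset n → Fin n → Pred (Fin n) 0ℓ
  Far U x u = u ∈ U × u ≢ x × ¬ E G x u

  far? : ∀ U x → Decidable (Far U x)
  far? U x u = u Subset.∈? U ×-dec ¬? (u Fin.≟ x) ×-dec ¬? (E? x u)

  module _ (chordal : Chordal G) where

    -- x dominates K but misses y₀; C is the component of y₀ in the part of
    -- U far from x, and its boundary S is a clique around x to recurse on.
    module Separator {U K : Subset n} {x y₀ : Fin n} (K-dominated : Dominates K x) (x∈U : x ∈ U)
                     (component-y₀ : Component (Far U x) y₀) where

      open Component component-y₀ renaming (members to C)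

      Boundary : Pred (Fin n) 0ℓ
      Boundary u = u ∈ U × u ∉ C × ∃ λ c → c ∈ C × E G c u

      boundary? : Decidable Boundary
      boundary? u = u Subset.∈? U ×-dec ¬? (u Subset.∈? C) ×-dec
                    Fin.any? (λ c → c Subset.∈? C ×-dec E? c u)

      S : Subset n
      S = subsetOf boundary?

      x-adjacent-boundary : ∀ {u} → Boundary u → E G x u
      x-adjacent-boundary {u} (u∈U , u∉C , c , c∈C , c∼u) with u Fin.≟ x
      ... | yes refl = ⊥-elim (proj₂ (proj₂ (⊆W c∈C)) (Graph.sym G c∼u))
      ... | no u≢x   = decidable-stable (E? x u) (λ x≁u → u∉C (closed c∈C (u∈U , u≢x , x≁u) c∼u))

      -- Two non-adjacent boundary vertices would be joined by a chordless
      -- walk through C, which x closes into an induced cycle.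
      boundary-clique : IsClique G S
      boundary-clique {a} {b} a∈S b∈S a≢b = decidable-stable (E? a b) λ a≁b →
        let p , p-chordless = shortcut E? around in
        chordal _ (s≤s (chordless-long p a≢b a≁b))
                  (closing-cycle p p-chordless x∼a x∼b (x∉Q ∘ walk-∈ p) (x≁inner ∘ walk-∈ p))
        where
        a-boundary : Boundary a
        a-boundary = ∈-subsetOf⁻ boundary? a∈S
        b-boundary : Boundary b
        b-boundary = ∈-subsetOf⁻ boundary? b∈S
        x∼a : E G x a
        x∼a = x-adjacent-boundary a-boundary
        x∼b : E G x b
        x∼b = x-adjacent-boundary b-boundary
        Q : Pred (Fin n) 0ℓ
        Q z = z ≡ a ⊎ z ∈ C ⊎ z ≡ b
        around : Walk Q a b
        around with a-boundary | b-boundary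
        ... | _ , _ , c₁ , c₁∈C , c₁∼a | _ , _ , c₂ , c₂∈C , c₂∼b =
          inj₁ refl ∷⟨ Graph.sym G c₁∼a ⟩
          walk-snoc (walk-map (inj₂ ∘ inj₁) (walk-reverse (connected c₁∈C) ++ʷ connected c₂∈C))
                    c₂∼b (inj₂ (inj₂ refl))
        x∉Q : ∀ {z} → Q z → x ≢ z
        x∉Q (inj₁ refl)        refl = Graph.irrefl G x∼a
        x∉Q (inj₂ (inj₁ z∈C))  x≡z  = proj₁ (proj₂ (⊆W z∈C)) (sym x≡z)
        x∉Q (inj₂ (inj₂ refl)) refl = Graph.irrefl G x∼b
        x≁inner : ∀ {z} → Q z → z ≢ a → z ≢ b → ¬ E G x z
        x≁inner (inj₁ z≡a)        z≢a _ = ⊥-elim (z≢a z≡a)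
        x≁inner (inj₂ (inj₁ z∈C)) _   _ = proj₂ (proj₂ (⊆W z∈C))
        x≁inner (inj₂ (inj₂ z≡b)) _ z≢b = ⊥-elim (z≢b z≡b)

      C∪S⊂U : C ∪ S ⊂ U
      C∪S⊂U =
        [ proj₁ ∘ ⊆W , proj₁ ∘ ∈-subsetOf⁻ boundary? ] ∘ Subset.x∈p∪q⁻ C S , x , x∈U ,
        [ (λ x∈C → proj₁ (proj₂ (⊆W x∈C)) refl)
        , (λ x∈S → Graph.irrefl G (x-adjacent-boundary (∈-subsetOf⁻ boundary? x∈S))) ] ∘ Subset.x∈p∪q⁻ C S

      simplicial-lift : ∀ {v} → v ∈ C → Simplicial G (C ∪ S) v → Simplicial G U v
      simplicial-lift {v} v∈C simplicial a∈U b∈U v∼a v∼b =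
        simplicial (into a∈U v∼a) (into b∈U v∼b) v∼a v∼b
        where
        into : ∀ {a} → a ∈ U → E G v a → a ∈ C ∪ S
        into {a} a∈U v∼a with a Subset.∈? C
        ... | yes a∈C = Subset.x∈p∪q⁺ (inj₁ a∈C)
        ... | no  a∉C = Subset.x∈p∪q⁺ (inj₂ (∈-subsetOf⁺ boundary? (a∈U , a∉C , v , v∈C , v∼a)))

      separator-case : WfRec _⊂_ SimplicialOutsideCliques U → SimplicialOutside U K
      separator-case rec
        with rec C∪S⊂U (Subset.q⊆p∪q C S) boundary-clique (Subset.x∈p∪q⁺ (inj₁ root))
                 (λ y₀∈S → proj₁ (proj₂ (∈-subsetOf⁻ boundary? y₀∈S)) root)
      ... | v , v∈C∪S , v∉S , simplicial = v , proj₁ (⊆W v∈C) , v∉K , simplicial-lift v∈C simplicial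
        where
        v∈C : v ∈ C
        v∈C = [ id , ⊥-elim ∘ v∉S ] (Subset.x∈p∪q⁻ C S v∈C∪S)
        v∉K : v ∉ K
        v∉K v∈K = let _ , v≢x , x≁v = ⊆W v∈C in [ v≢x , x≁v ] (K-dominated v v∈K)

    -- Either K is empty and u₀ is universal, hence simplicial, or some
    -- k₀ ∈ K is universal and can be deleted from both U and K.
    universal-case : ∀ {U} → WfRec _⊂_ SimplicialOutsideCliques U →
      ∀ {K} → K ⊆ U → IsClique G K → ∀ {u₀} → u₀ ∈ U → u₀ ∉ K →
      (∀ {x} → x ∈ U → Dominates K x → Universal U x) → SimplicialOutside U K
    universal-case {U} rec {K} K⊆U clique {u₀} u₀∈U u₀∉K universal with Subset.nonempty? K
    ... | no K-empty = u₀ , u₀∈U , u₀∉K , λ a∈U b∈U _ _ a≢b →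
      universal a∈U (λ y y∈K → ⊥-elim (K-empty (y , y∈K))) b∈U (a≢b ∘ sym)
    ... | yes (k₀ , k₀∈K)
      with rec (Subset.x∈p⇒p-x⊂p (K⊆U k₀∈K)) K′⊆U′
               (λ a∈ b∈ → clique (proj₁ (∈-remove⁻ a∈)) (proj₁ (∈-remove⁻ b∈)))
               (Subset.x∈p∧x≢y⇒x∈p-y u₀∈U u₀≢k₀) (u₀∉K ∘ proj₁ ∘ ∈-remove⁻)
      where
      K′⊆U′ : K - k₀ ⊆ U - k₀
      K′⊆U′ u∈ = let u∈K , u≢k₀ = ∈-remove⁻ u∈ in Subset.x∈p∧x≢y⇒x∈p-y (K⊆U u∈K) u≢k₀
      u₀≢k₀ : u₀ ≢ k₀
      u₀≢k₀ refl = u₀∉K k₀∈K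
    ... | v , v∈U′ , v∉K′ , simplicial = v , proj₁ (∈-remove⁻ v∈U′) , v∉K , simplicial-U
      where
      v≢k₀ : v ≢ k₀
      v≢k₀ = proj₂ (∈-remove⁻ v∈U′)
      v∉K : v ∉ K
      v∉K v∈K = v∉K′ (Subset.x∈p∧x≢y⇒x∈p-y v∈K v≢k₀)
      k₀-universal : Universal U k₀
      k₀-universal = universal (K⊆U k₀∈K) λ y y∈K → case y Fin.≟ k₀ of λ
        { (yes y≡k₀) → inj₁ y≡k₀ ; (no y≢k₀) → inj₂ (clique k₀∈K y∈K (y≢k₀ ∘ sym)) }
      simplicial-U : Simplicial G U v
      simplicial-U {a} {b} a∈U b∈U v∼a v∼b a≢b with a Fin.≟ k₀ | b Fin.≟ k₀
      ... | yes refl | _        = k₀-universal b∈U (a≢b ∘ sym)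
      ... | no a≢k₀  | yes refl = Graph.sym G (k₀-universal a∈U a≢k₀)
      ... | no a≢k₀  | no b≢k₀  =
        simplicial (Subset.x∈p∧x≢y⇒x∈p-y a∈U a≢k₀) (Subset.x∈p∧x≢y⇒x∈p-y b∈U b≢k₀) v∼a v∼b a≢b

    simplicial-outside-clique : ∀ U → SimplicialOutsideCliques U
    simplicial-outside-clique = WF.All.wfRec ⊂-wellFounded 0ℓ SimplicialOutsideCliques step
      where
      dominates? : ∀ K x → Dec (Dominates K x)
      dominates? K x = Fin.all? (λ y → y Subset.∈? K →-dec (y Fin.≟ x ⊎-dec E? x y))
      step : ∀ U → WfRec _⊂_ SimplicialOutsideCliques U → SimplicialOutsideCliques U
      step U rec {K} K⊆U clique u₀∈U u₀∉K
        with Fin.any? (λ x → x Subset.∈? U ×-dec dominates? K x ×-dec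
                             Fin.any? (λ y → y Subset.∈? U ×-dec ¬? (y Fin.≟ x) ×-dec ¬? (E? x y)))
      ... | yes (x , x∈U , dominated , y₀ , y₀-far) =
        Separator.separator-case dominated x∈U (component (far? U x) y₀-far) rec
      ... | no ¬separating = universal-case rec K⊆U clique u₀∈U u₀∉K λ {x} x∈U dominated {y} y∈U y≢x →
        decidable-stable (E? x y) (λ x≁y → ¬separating (x , x∈U , dominated , y , y∈U , y≢x , x≁y))

-- The 1-skeleton and flag complexes

pair : Fin n → Fin n → Subset n
pair u v = ⁅ u ⁆ [ v ]≔ true

∈-pair-left : (u v : Fin n) → u ∈ pair u v
∈-pair-left u v = ∈-insert⁺ v (Subset.x∈⁅x⁆ u)

∈-pair-right : (u v : Fin n) → v ∈ pair u v
∈-pair-right u v = ∈-insert-self ⁅ u ⁆ v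

∈-pair⁻ : {u v w : Fin n} → w ∈ pair u v → w ≡ u ⊎ w ≡ v
∈-pair⁻ w∈ with ∈-insert⁻ w∈
... | inj₁ w≡v     = inj₂ w≡v
... | inj₂ w∈⁅u⁆ = inj₁ (Subset.x∈⁅y⁆⇒x≡y _ w∈⁅u⁆)

pair-⊆ : {S : Subset n} {u v : Fin n} → u ∈ S → v ∈ S → pair u v ⊆ S
pair-⊆ {S = S} u∈S v∈S w∈ =
  [ (λ w≡u → subst (_∈ S) (sym w≡u) u∈S) , (λ w≡v → subst (_∈ S) (sym w≡v) v∈S) ] (∈-pair⁻ w∈)

pair-comm : (u v : Fin n) → pair u v ≡ pair v u
pair-comm u v = Subset.⊆-antisym (pair-⊆ (∈-pair-right v u) (∈-pair-left v u))
                                 (pair-⊆ (∈-pair-right u v) (∈-pair-left u v))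

pair-diag : (u : Fin n) → pair u u ≡ ⁅ u ⁆
pair-diag u = Subset.⊆-antisym (pair-⊆ (Subset.x∈⁅x⁆ u) (Subset.x∈⁅x⁆ u))
                               (λ w∈ → subst (_∈ pair u u) (sym (Subset.x∈⁅y⁆⇒x≡y u w∈)) (∈-pair-left u u))

∅-insert : (v : Fin n) → ∅ [ v ]≔ true ≡ ⁅ v ⁆
∅-insert zero    = refl
∅-insert (suc v) = cong (false ∷_) (∅-insert v)

skeleton : Family n → Graph n
skeleton X = record
  { E      = λ u v → u ≢ v × X (pair u v) ≡ true
  ; sym    = λ { (u≢v , uv) → u≢v ∘ sym , face-subst X (pair-comm _ _) uv }
  ; irrefl = λ { (u≢u , _) → u≢u refl }
  }

skeleton? : (X : Family n) → ∀ u v → Dec (E (skeleton X) u v)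
skeleton? X u v = ¬? (u Fin.≟ v) ×-dec X (pair u v) ≟ᵇ true

edge-vertex : (X : Family n) → IsSimplicialComplex X → ∀ {u v} → E (skeleton X) u v → X ⁅ u ⁆ ≡ true
edge-vertex X sc (_ , uv) = vertex-of-face X sc uv (∈-pair-left _ _)

skeleton-del⇔ : (X : Family n) {u v w : Fin n} → u ≢ v → w ≢ v →
  E (skeleton (del X v)) u w ⇔ E (skeleton X) u w
skeleton-del⇔ X u≢v w≢v = mk⇔ (λ (u≢w , e) → u≢w , proj₁ (del-face⁻ X e))
                              (λ (u≢w , e) → u≢w , del-face⁺ X e ([ u≢v ∘ sym , w≢v ∘ sym ] ∘ ∈-pair⁻))

IsFlag : Family n → Set
IsFlag X = ∀ S → (∀ {u v} → u ∈ S → v ∈ S → X (pair u v) ≡ true) → X S ≡ true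

ChordalFlag : Family n → Set
ChordalFlag X = IsFlag X × Chordal (skeleton X)

nonadjacent⇒nonCone : (X : Family n) {v w : Fin n} → X ⁅ v ⁆ ≡ true → X ⁅ w ⁆ ≡ true → w ≢ v →
  ¬ E (skeleton X) v w → isNonCone X v ≡ true
nonadjacent⇒nonCone X xv xw w≢v v≁w = failure⇒isNonCone X xv
  (⁅ _ ⁆ , xw , Subset.x≢y⇒x∉⁅y⁆ (w≢v ∘ sym) ,
   ≢true⇒≡false λ xwv → v≁w (w≢v ∘ sym , face-subst X (pair-comm _ _) xwv))

-- θ ≤ 1 forces a flag complex with chordal 1-skeleton

module _ (X : Family n) (x∅ : X ∅ ≡ true) (allCone : AllCone X) where

  allCone-flag : IsFlag X
  allCone-flag S pairs = allCone-simplex X x∅ allCone S λ {u} u∈ → face-subst X (pair-diag u) (pairs u∈ u∈)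

  allCone-chordal : IsSimplicialComplex X → Chordal (skeleton X)
  allCone-chordal sc zero    ()
  allCone-chordal sc (suc k) k≥4 cycle = simplicial-∉-cycle (skeleton X) k≥4 cycle zero λ c∼a c∼b a≢b →
    a≢b , allCone-simplex X x∅ allCone _ λ w∈ →
      [ (λ { refl → edge-vertex X sc (Graph.sym (skeleton X) c∼a) })
      , (λ { refl → edge-vertex X sc (Graph.sym (skeleton X) c∼b) }) ] (∈-pair⁻ w∈)

module _ (X : Family n) (sc : IsSimplicialComplex X) {v : Fin n} (xv : X ⁅ v ⁆ ≡ true)
         (link-simplex : AllCone (lk X v)) where

  cone-over-link : ∀ S → v ∉ S → (∀ {u} → u ∈ S → X (pair u v) ≡ true) → X (S [ v ]≔ true) ≡ true
  cone-over-link S v∉S pairs =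
    proj₂ (proj₂ (lk-face⁻ X (allCone-simplex (lk X v) lk∅ link-simplex S link-vertex)))
    where
    lk∅ : lk X v ∅ ≡ true
    lk∅ = lk-face⁺ X (∅-face X sc xv) Subset.∉⊥ (face-subst X (sym (∅-insert v)) xv)
    link-vertex : ∀ {u} → u ∈ S → lk X v ⁅ u ⁆ ≡ true
    link-vertex {u} u∈S = lk-face⁺ X (vertex-of-face X sc (pairs u∈S) (∈-pair-left u v))
      (v∉S ∘ ⁅x⁆⊆ u∈S) (pairs u∈S)

  flag-extend : IsFlag (del X v) → IsFlag X
  flag-extend del-flag S pairs with v Subset.∈? S
  ... | yes v∈S = face-subst X (remove-insert v∈S)
    (cone-over-link (S - v) (∉-remove S v) λ u∈ → pairs (proj₁ (∈-remove⁻ u∈)) v∈S)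
  ... | no v∉S =
    proj₁ (del-face⁻ X (del-flag S λ u∈ w∈ → del-face⁺ X (pairs u∈ w∈) (v∉S ∘ pair-⊆ u∈ w∈)))

  chordal-extend : Chordal (skeleton (del X v)) → Chordal (skeleton X)
  chordal-extend del-chordal k k≥4 cycle@(c , c-inj , c-adj) with Fin.any? (λ i → c i Fin.≟ v)
  ... | yes (i , ci≡v) =
    simplicial-∉-cycle (skeleton X) k≥4 cycle i
      (subst (CliqueNeighbourhood (skeleton X)) (sym ci≡v) v-simplicial)
    where
    v-simplicial : CliqueNeighbourhood (skeleton X) v
    v-simplicial {a} {b} (v≢a , va) (v≢b , vb) a≢b =
      a≢b , sc _ _ (∈-insert⁺ v) (cone-over-link (pair a b) ([ v≢a , v≢b ] ∘ ∈-pair⁻) pairs)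
      where
      pairs : ∀ {u} → u ∈ pair a b → X (pair u v) ≡ true
      pairs u∈ with ∈-pair⁻ u∈
      ... | inj₁ refl = face-subst X (pair-comm v a) va
      ... | inj₂ refl = face-subst X (pair-comm v b) vb
  ... | no avoids-v = del-chordal k k≥4 (c , c-inj , λ i j →
    ⇔.trans (skeleton-del⇔ X (avoids-v ∘ (i ,_)) (avoids-v ∘ (j ,_))) (c-adj i j))

θ≤1⇒chordalFlag : ∀ k (X : Family n) → IsSimplicialComplex X → X ∅ ≡ true →
  ∣ vertexSet X ∣ < k → thetaF k X ≤ 1 → ChordalFlag X
θ≤1⇒chordalFlag (suc k) X sc x∅ fuel θ≤1 with thetaF-cases k X
... | inj₁ (allCone , _) = allCone-flag X x∅ allCone , allCone-chordal X x∅ allCone sc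
... | inj₂ (v , nonCone , θ≡) =
  flag-extend X sc xv link-simplex (proj₁ del-chordalFlag) ,
  chordal-extend X sc xv link-simplex (proj₂ del-chordalFlag)
  where
  xv : X ⁅ v ⁆ ≡ true
  xv = isNonCone⇒vertex X nonCone
  step≤1 : θ-step k X v ≤ 1
  step≤1 = subst (_≤ 1) θ≡ θ≤1
  del-chordalFlag : ChordalFlag (del X v)
  del-chordalFlag = θ≤1⇒chordalFlag k (del X v) (del-isSimplicialComplex X sc v) (del-face⁺ X x∅ Subset.∉⊥)
                      (fuel-del X xv fuel) (ℕ.m⊔n≤o⇒m≤o _ _ step≤1)
  link-simplex : AllCone (lk X v)
  link-simplex = thetaF≡0⇒allCone (fuel-lk X xv fuel) (ℕ.n≤0⇒n≡0 (ℕ.≤-pred (ℕ.m⊔n≤o⇒n≤o _ _ step≤1)))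

-- A flag complex with chordal 1-skeleton has θ ≤ 1

module _ (X : Family n) (sc : IsSimplicialComplex X) (flag : IsFlag X) where

  flag-insert : ∀ {S w} → X S ≡ true → X ⁅ w ⁆ ≡ true → (∀ {u} → u ∈ S → X (pair u w) ≡ true) →
    X (S [ w ]≔ true) ≡ true
  flag-insert {S} {w} xS xw pairs = flag _ λ a∈ b∈ → pair-face (∈-insert⁻ a∈) (∈-insert⁻ b∈)
    where
    pair-face : ∀ {a b} → a ≡ w ⊎ a ∈ S → b ≡ w ⊎ b ∈ S → X (pair a b) ≡ true
    pair-face (inj₁ refl) (inj₁ refl) = face-subst X (sym (pair-diag w)) xw
    pair-face (inj₁ refl) (inj₂ b∈S)  = face-subst X (pair-comm _ w) (pairs b∈S)
    pair-face (inj₂ a∈S)  (inj₁ refl) = pairs a∈S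
    pair-face (inj₂ a∈S)  (inj₂ b∈S)  = sc _ _ (pair-⊆ a∈S b∈S) xS

  universal⇒cone : ∀ {v} → X ⁅ v ⁆ ≡ true →
    (∀ {w} → X ⁅ w ⁆ ≡ true → w ≢ v → E (skeleton X) v w) → IsCone X v
  universal⇒cone {v} xv universal T xT v∉T = flag-insert xT xv λ {u} u∈T →
    face-subst X (pair-comm v u)
      (proj₂ (universal (vertex-of-face X sc xT u∈T) (λ u≡v → v∉T (subst (_∈ T) u≡v u∈T))))

  nonCone⇒nonadjacent : ∀ {v} → isNonCone X v ≡ true →
    ∃ λ w → X ⁅ w ⁆ ≡ true × w ≢ v × ¬ E (skeleton X) v w
  nonCone⇒nonadjacent {v} nonCone
    with Fin.any? (λ w → X ⁅ w ⁆ ≟ᵇ true ×-dec ¬? (w Fin.≟ v) ×-dec ¬? (skeleton? X v w))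
  ... | yes found = found
  ... | no none =
    let xv , ¬cone = Equivalence.to (isNonCone⇔ X) nonCone in
    ⊥-elim (¬cone (universal⇒cone xv λ {w} xw w≢v →
      decidable-stable (skeleton? X v w) λ v≁w → none (w , xw , w≢v , v≁w)))

  simplicial⇒link-simplex : ∀ {v} → Simplicial (skeleton X) (vertexSet X) v → AllCone (lk X v)
  simplicial⇒link-simplex {v} simplicial w = ≢true⇒≡false λ nonCone →
    let lkw , ¬cone = Equivalence.to (isNonCone⇔ (lk X v)) nonCone in ¬cone (link-cone lkw)
    where
    link-cone : lk X v ⁅ w ⁆ ≡ true → IsCone (lk X v) w
    link-cone lkw T lkT w∉T with lk-face⁻ X lkw | lk-face⁻ X lkT
    ... | xw , v∉⁅w⁆ , xwv | xT , v∉T , xTv = lk-face⁺ X (sc _ _ (∈-insert⁺ v) xTwv) v∉Tw xTwv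
      where
      w≢v : w ≢ v
      w≢v w≡v = v∉⁅w⁆ (subst (_∈ ⁅ w ⁆) w≡v (Subset.x∈⁅x⁆ w))
      v∼w : E (skeleton X) v w
      v∼w = w≢v ∘ sym , face-subst X (pair-comm w v) xwv
      w-adjacent : ∀ {u} → u ∈ T [ v ]≔ true → X (pair u w) ≡ true
      w-adjacent u∈ with ∈-insert⁻ u∈
      ... | inj₁ refl = proj₂ v∼w
      ... | inj₂ u∈T  = proj₂ (simplicial (∈-vertexSet⁺ X (vertex-of-face X sc xT u∈T)) (∈-vertexSet⁺ X xw)
          ((λ v≡u → v∉T (subst (_∈ T) (sym v≡u) u∈T)) , sc _ _ (pair-⊆ (∈-insert-self T v) u∈) xTv)
          v∼w (λ u≡w → w∉T (subst (_∈ T) u≡w u∈T)))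
      xTwv : X ((T [ w ]≔ true) [ v ]≔ true) ≡ true
      xTwv = face-subst X (insert-comm T v w) (flag-insert xTv xw w-adjacent)
      v∉Tw : v ∉ T [ w ]≔ true
      v∉Tw = [ w≢v ∘ sym , v∉T ] ∘ ∈-insert⁻

  flag-del : ∀ v → IsFlag (del X v)
  flag-del v S pairs = del-face⁺ X (flag S λ u∈ w∈ → proj₁ (del-face⁻ X (pairs u∈ w∈)))
    (λ v∈S → proj₂ (del-face⁻ X (pairs v∈S v∈S)) (∈-pair-left v v))

  chordal-del : Chordal (skeleton X) → ∀ v → Chordal (skeleton (del X v))
  chordal-del chordal v k k≥4 (c , c-inj , c-adj) =
    chordal k k≥4 (c , c-inj , λ i j → ⇔.trans (⇔.sym (skeleton-del⇔ X (avoids-v i) (avoids-v j))) (c-adj i j))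
    where
    avoids-v : ∀ i → c i ≢ v
    avoids-v i ci≡v =
      let j , i~j = cycle-neighbour k≥4 i
          _ , e   = Equivalence.from (c-adj i j) i~j
      in proj₂ (del-face⁻ X e) (subst (_∈ pair (c i) (c j)) ci≡v (∈-pair-left (c i) (c j)))

  -- Were v adjacent to both v₀ and w₀, simpliciality would join them.
  simplicial⇒nonCone : ∀ {v v₀ w₀} → v ∈ vertexSet X → v ≢ v₀ → Simplicial (skeleton X) (vertexSet X) v →
    X ⁅ v₀ ⁆ ≡ true → X ⁅ w₀ ⁆ ≡ true → w₀ ≢ v₀ → ¬ E (skeleton X) v₀ w₀ → isNonCone X v ≡ true
  simplicial⇒nonCone {v} {v₀} {w₀} v∈V v≢v₀ simplicial xv₀ xw₀ w₀≢v₀ v₀≁w₀ with skeleton? X v v₀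
  ... | no v≁v₀ = nonadjacent⇒nonCone X (∈-vertexSet⁻ X v∈V) xv₀ (v≢v₀ ∘ sym) v≁v₀
  ... | yes v∼v₀ with v Fin.≟ w₀
  ...   | yes refl = ⊥-elim (v₀≁w₀ (Graph.sym (skeleton X) v∼v₀))
  ...   | no v≢w₀ with skeleton? X v w₀
  ...     | no v≁w₀  = nonadjacent⇒nonCone X (∈-vertexSet⁻ X v∈V) xw₀ (v≢w₀ ∘ sym) v≁w₀
  ...     | yes v∼w₀ =
    ⊥-elim (v₀≁w₀ (simplicial (∈-vertexSet⁺ X xv₀) (∈-vertexSet⁺ X xw₀) v∼v₀ v∼w₀ (w₀≢v₀ ∘ sym)))

  simplicial-nonCone : Chordal (skeleton X) → ∀ {v₀} → isNonCone X v₀ ≡ true →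
    ∃ λ v → isNonCone X v ≡ true × Simplicial (skeleton X) (vertexSet X) v
  simplicial-nonCone chordal {v₀} nonCone₀ with nonCone⇒nonadjacent nonCone₀
  ... | w₀ , xw₀ , w₀≢v₀ , v₀≁w₀ =
    let v , v∈V , v∉⁅v₀⁆ , simplicial =
          simplicial-outside-clique (skeleton X) (skeleton? X) chordal (vertexSet X)
            (⁅x⁆⊆ (∈-vertexSet⁺ X xv₀)) (singleton-clique (skeleton X) v₀)
            (∈-vertexSet⁺ X xw₀) (Subset.x≢y⇒x∉⁅y⁆ w₀≢v₀)
    in v , simplicial⇒nonCone v∈V (Subset.x∉⁅y⁆⇒x≢y v∉⁅v₀⁆) simplicial xv₀ xw₀ w₀≢v₀ v₀≁w₀ , simplicial
    where
    xv₀ : X ⁅ v₀ ⁆ ≡ true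
    xv₀ = isNonCone⇒vertex X nonCone₀

chordalFlag⇒θ≤1 : ∀ k (X : Family n) → IsSimplicialComplex X → ChordalFlag X →
  ∣ vertexSet X ∣ < k → thetaF k X ≤ 1
chordalFlag⇒θ≤1 zero    X sc _ _ = z≤n
chordalFlag⇒θ≤1 (suc k) X sc (flag , chordal) fuel with thetaF-cases k X
... | inj₁ (_ , θ≡0) = subst (_≤ 1) (sym θ≡0) z≤n
... | inj₂ (v₀ , nonCone₀ , _) with simplicial-nonCone X sc flag chordal nonCone₀
...   | v , nonCone , simplicial = ℕ.≤-trans (thetaF-≤-step k X nonCone) (ℕ.⊔-lub del≤1 lk≤1)
  where
  xv : X ⁅ v ⁆ ≡ true
  xv = isNonCone⇒vertex X nonCone
  del≤1 : thetaF k (del X v) ≤ 1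
  del≤1 = chordalFlag⇒θ≤1 k (del X v) (del-isSimplicialComplex X sc v)
            (flag-del X sc flag v , chordal-del X sc flag chordal v) (fuel-del X xv fuel)
  lk≤1 : suc (thetaF k (lk X v)) ≤ 1
  lk≤1 = s≤s (ℕ.≤-reflexive (thetaF-allCone k (simplicial⇒link-simplex X sc flag simplicial)))

-- Flag complexes as independence complexes

lookup-injective : ∀ {A : Set} {xs : List A} → Unique xs → Injective _≡_ _≡_ (List.lookup xs)
lookup-injective (_ ∷ _)      {zero}  {zero}  _  = refl
lookup-injective (x∉xs ∷ _)   {zero}  {suc j} eq = ⊥-elim (All.lookup x∉xs (∈-lookup j) eq)
lookup-injective (x∉xs ∷ _)   {suc i} {zero}  eq = ⊥-elim (All.lookup x∉xs (∈-lookup i) (sym eq))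
lookup-injective (_ ∷ unique) {suc i} {suc j} eq = cong suc (lookup-injective unique eq)

complement-involutive : (H : Graph m) → (∀ u v → Dec (E H u v)) →
  ∀ u v → E (complement (complement H)) u v ⇔ E H u v
complement-involutive H E? u v = mk⇔
  (λ (u≢v , ¬missing) → decidable-stable (E? u v) λ ¬e → ¬missing (u≢v , ¬e))
  (λ e → (λ { refl → Graph.irrefl H e }) , λ (_ , ¬e) → ¬e e)

ImageOfIndependent : (G : Graph m) → (Fin m → Fin n) → Subset n → Set
ImageOfIndependent {m} G ι S =
  Σ (Subset m) λ T → Independent G T × (∀ v → v ∈ S ⇔ ∃ λ i → i ∈ T × ι i ≡ v)

module Enumeration (X : Family n) where

  private
    vertex? : ∀ u → Dec (X ⁅ u ⁆ ≡ true)
    vertex? u = X ⁅ u ⁆ ≟ᵇ true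

  vertexList : List (Fin n)
  vertexList = List.filter vertex? (List.allFin n)

  label : Fin (length vertexList) → Fin n
  label = List.lookup vertexList

  label-injective : Injective _≡_ _≡_ label
  label-injective = lookup-injective (filter⁺ vertex? (allFin⁺ n))

  label-vertex : ∀ i → X ⁅ label i ⁆ ≡ true
  label-vertex i = proj₂ (∈-filter⁻ vertex? {xs = List.allFin n} (∈-lookup i))

  label-onto : ∀ {u} → X ⁅ u ⁆ ≡ true → ∃ λ i → label i ≡ u
  label-onto xu = let u∈ = ∈-filter⁺ vertex? (∈-allFin _) xu in Any.index u∈ , sym (lookup-index u∈)

module _ (X : Family n) (sc : IsSimplicialComplex X) {ι : Fin m → Fin n}
         (ι-injective : Injective _≡_ _≡_ ι) (ι-vertex : ∀ i → X ⁅ ι i ⁆ ≡ true)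
         (ι-onto : ∀ {u} → X ⁅ u ⁆ ≡ true → ∃ λ i → ι i ≡ u) where

  nonEdges : Graph m
  nonEdges = complement (comap ι (skeleton X))

  flag⇒isIndOf : IsFlag X → IsIndOf X nonEdges ι
  flag⇒isIndOf flag = ι-injective , λ S → mk⇔ (to S) (from S)
    where
    to : ∀ S → X S ≡ true → ImageOfIndependent nonEdges ι S
    to S xS = T , independent , λ v → mk⇔ (preimage v) image
      where
      ι∈S? : ∀ i → Dec (ι i ∈ S)
      ι∈S? i = ι i Subset.∈? S
      T : Subset m
      T = subsetOf ι∈S?
      independent : Independent nonEdges T
      independent i j i∈T j∈T (i≢j , ¬adjacent) =
        ¬adjacent (i≢j ∘ ι-injective , sc _ _ (pair-⊆ (∈-subsetOf⁻ ι∈S? i∈T) (∈-subsetOf⁻ ι∈S? j∈T)) xS)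
      preimage : ∀ v → v ∈ S → ∃ λ i → i ∈ T × ι i ≡ v
      preimage v v∈S = let i , ιi≡v = ι-onto (vertex-of-face X sc xS v∈S) in
        i , ∈-subsetOf⁺ ι∈S? (subst (_∈ S) (sym ιi≡v) v∈S) , ιi≡v
      image : ∀ {v} → (∃ λ i → i ∈ T × ι i ≡ v) → v ∈ S
      image (i , i∈T , refl) = ∈-subsetOf⁻ ι∈S? i∈T
    from : ∀ S → ImageOfIndependent nonEdges ι S → X S ≡ true
    from S (T , independent , members) = flag S λ a∈ b∈ →
      pair-face (Equivalence.to (members _) a∈) (Equivalence.to (members _) b∈)
      where
      pair-face : ∀ {a b} → (∃ λ i → i ∈ T × ι i ≡ a) → (∃ λ j → j ∈ T × ι j ≡ b) → X (pair a b) ≡ true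
      pair-face (i , i∈T , refl) (j , j∈T , refl) with i Fin.≟ j
      ... | yes refl = face-subst X (sym (pair-diag (ι i))) (ι-vertex i)
      ... | no i≢j   = proj₂ (decidable-stable (skeleton? X (ι i) (ι j)) λ ¬adjacent →
                         independent i j i∈T j∈T (i≢j , ¬adjacent))

  chordal⇒coChordal : Chordal (skeleton X) → CoChordal nonEdges
  chordal⇒coChordal chordal =
    Chordal-resp {G = comap ι (skeleton X)} {H = complement nonEdges}
      (λ i j → ⇔.sym (complement-involutive (comap ι (skeleton X)) (λ i j → skeleton? X (ι i) (ι j)) i j))
      (Chordal-comap {G = skeleton X} ι-injective chordal)

module _ (X : Family n) (sc : IsSimplicialComplex X) (G : Graph m) (ι : Fin m → Fin n)
         (ind : IsIndOf X G ι) where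

  private
    ι-injective : Injective _≡_ _≡_ ι
    ι-injective = proj₁ ind
    faces : ∀ S → X S ≡ true ⇔ ImageOfIndependent G ι S
    faces = proj₂ ind

  pair-face⇔ : ∀ i j → X (pair (ι i) (ι j)) ≡ true ⇔ (¬ E G i j)
  pair-face⇔ i j = mk⇔ to from
    where
    to : X (pair (ι i) (ι j)) ≡ true → ¬ E G i j
    to x with Equivalence.to (faces _) x
    ... | T , independent , members
      with Equivalence.to (members _) (∈-pair-left (ι i) (ι j))
         | Equivalence.to (members _) (∈-pair-right (ι i) (ι j))
    ...   | i′ , i′∈T , ιi′≡ιi | j′ , j′∈T , ιj′≡ιj with ι-injective ιi′≡ιi | ι-injective ιj′≡ιj
    ...     | refl | refl = independent i j i′∈T j′∈T
    from : ¬ E G i j → X (pair (ι i) (ι j)) ≡ true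
    from i≁j = Equivalence.from (faces _) (pair i j , independent , λ v → mk⇔ preimage image)
      where
      independent : Independent G (pair i j)
      independent a b a∈ b∈ with ∈-pair⁻ a∈ | ∈-pair⁻ b∈
      ... | inj₁ refl | inj₁ refl = Graph.irrefl G
      ... | inj₁ refl | inj₂ refl = i≁j
      ... | inj₂ refl | inj₁ refl = i≁j ∘ Graph.sym G
      ... | inj₂ refl | inj₂ refl = Graph.irrefl G
      preimage : ∀ {v} → v ∈ pair (ι i) (ι j) → ∃ λ k → k ∈ pair i j × ι k ≡ v
      preimage v∈ with ∈-pair⁻ v∈
      ... | inj₁ refl = i , ∈-pair-left i j , refl
      ... | inj₂ refl = j , ∈-pair-right i j , refl
      image : ∀ {v} → (∃ λ k → k ∈ pair i j × ι k ≡ v) → v ∈ pair (ι i) (ι j)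
      image (k , k∈ , refl) with ∈-pair⁻ k∈
      ... | inj₁ refl = ∈-pair-left (ι i) (ι j)
      ... | inj₂ refl = ∈-pair-right (ι i) (ι j)

  ι-vertex : ∀ i → X ⁅ ι i ⁆ ≡ true
  ι-vertex i = face-subst X (pair-diag (ι i)) (Equivalence.from (pair-face⇔ i i) (Graph.irrefl G))

  ι-onto : ∀ {u} → X ⁅ u ⁆ ≡ true → ∃ λ i → ι i ≡ u
  ι-onto {u} xu = let _ , _ , members = Equivalence.to (faces _) xu
                      i , _ , ιi≡u    = Equivalence.to (members u) (Subset.x∈⁅x⁆ u)
                  in i , ιi≡u

  isIndOf⇒flag : IsFlag X
  isIndOf⇒flag S pairs = Equivalence.from (faces S) (T , independent , λ v → mk⇔ (preimage v) image)
    where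
    ι∈S? : ∀ i → Dec (ι i ∈ S)
    ι∈S? i = ι i Subset.∈? S
    T : Subset m
    T = subsetOf ι∈S?
    independent : Independent G T
    independent i j i∈T j∈T =
      Equivalence.to (pair-face⇔ i j) (pairs (∈-subsetOf⁻ ι∈S? i∈T) (∈-subsetOf⁻ ι∈S? j∈T))
    preimage : ∀ v → v ∈ S → ∃ λ i → i ∈ T × ι i ≡ v
    preimage v v∈S = let i , ιi≡v = ι-onto (face-subst X (pair-diag v) (pairs v∈S v∈S)) in
      i , ∈-subsetOf⁺ ι∈S? (subst (_∈ S) (sym ιi≡v) v∈S) , ιi≡v
    image : ∀ {v} → (∃ λ i → i ∈ T × ι i ≡ v) → v ∈ S
    image (i , i∈T , refl) = ∈-subsetOf⁻ ι∈S? i∈T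

  coChordal⇒chordal : CoChordal G → Chordal (skeleton X)
  coChordal⇒chordal coChordal =
    Chordal-comap⁻ {G = skeleton X} {ι = ι} (ι-onto ∘ edge-vertex X sc)
      (Chordal-resp {G = complement G} {H = comap ι (skeleton X)} complement⇔ coChordal)
    where
    complement⇔ : ∀ i j → E (complement G) i j ⇔ E (comap ι (skeleton X)) i j
    complement⇔ i j = mk⇔ (λ (i≢j , i≁j) → i≢j ∘ ι-injective , Equivalence.from (pair-face⇔ i j) i≁j)
                          (λ (ιi≢ιj , x) → ιi≢ιj ∘ cong ι , Equivalence.to (pair-face⇔ i j) x)

HasNonCone : Family n → Set
HasNonCone X = ∃ λ v → isNonCone X v ≡ true

IsIndOfCoChordalWithEdge : Family n → Set₁
IsIndOfCoChordalWithEdge {n} X =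
  Σ ℕ λ m → Σ (Graph m) λ G → Σ (Fin m → Fin n) λ ι → CoChordal G × HasEdge G × IsIndOf X G ι

θ≡1⇔chordalFlag : (X : Family n) → IsSimplicialComplex X →
  (θ X ≡ 1) ⇔ (ChordalFlag X × HasNonCone X)
θ≡1⇔chordalFlag {n} X sc = mk⇔ to from
  where
  to : θ X ≡ 1 → ChordalFlag X × HasNonCone X
  to θ≡1 with thetaF-cases n X
  ... | inj₁ (_ , θ≡0) = case trans (sym θ≡1) θ≡0 of λ ()
  ... | inj₂ (v , nonCone , _) =
    θ≤1⇒chordalFlag (suc n) X sc (∅-face X sc (isNonCone⇒vertex X nonCone))
      (fuel-θ X) (ℕ.≤-reflexive θ≡1) ,
    v , nonCone
  from : ChordalFlag X × HasNonCone X → θ X ≡ 1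
  from (chordalFlag , v , nonCone) =
    ℕ.≤-antisym (chordalFlag⇒θ≤1 (suc n) X sc chordalFlag (fuel-θ X)) (thetaF-positive n X nonCone)

chordalFlag⇔indCoChordal : (X : Family n) → IsSimplicialComplex X →
  (ChordalFlag X × HasNonCone X) ⇔ IsIndOfCoChordalWithEdge X
chordalFlag⇔indCoChordal X sc = mk⇔ to from
  where
  open Enumeration X
  to : ChordalFlag X × HasNonCone X → IsIndOfCoChordalWithEdge X
  to ((flag , chordal) , v , nonCone) =
    _ , nonEdges X sc label-injective label-vertex label-onto , label ,
    chordal⇒coChordal X sc label-injective label-vertex label-onto chordal , edge ,
    flag⇒isIndOf X sc label-injective label-vertex label-onto flag
    where
    edge : HasEdge (nonEdges X sc label-injective label-vertex label-onto)
    edge with nonCone⇒nonadjacent X sc flag nonCone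
    ... | w , xw , w≢v , v≁w with label-onto (isNonCone⇒vertex X nonCone) | label-onto xw
    ...   | i , refl | j , refl = i , j , (λ { refl → w≢v refl }) , v≁w
  from : IsIndOfCoChordalWithEdge X → ChordalFlag X × HasNonCone X
  from (m , G , ι , coChordal , (i , j , i∼j) , ind) =
    (isIndOf⇒flag X sc G ι ind , coChordal⇒chordal X sc G ι ind coChordal) ,
    ι i , nonadjacent⇒nonCone X (ι-vertex X sc G ι ind i) (ι-vertex X sc G ι ind j)
            (λ ιj≡ιi → Graph.irrefl G (subst (E G i) (proj₁ ind ιj≡ιi) i∼j))
            (λ (_ , x) → Equivalence.to (pair-face⇔ X sc G ι ind i j) x i∼j)

theorem20 : ∀ {n} (X : Family n) → IsSimplicialComplex X →
    (θ X ≡ 1) ⇔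
    (Σ ℕ λ m → Σ (Graph m) λ G → Σ (Fin m → Fin n) λ ι →
      CoChordal G × HasEdge G × IsIndOf X G ι)
theorem20 X sc = ⇔.trans (θ≡1⇔chordalFlag X sc) (chordalFlag⇔indCoChordal X sc)
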